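{- Let $n\ge 2$ and let $k_1,\dots,k_r$ be integers with $k_i\ge 1$ for $i<r$, $k_r\ge 2$ and $k_1+\dots+k_r=n$. Put $M_1=x_1\cdots x_{k_1}$, $M_2=x_{k_1+1}\cdots x_{k_1+k_2}$, $\dots$, $M_r=x_{k_1+\dots+k_{r-1}+1}\cdots x_n$ and $$f(x_1,\dots,x_n)=M_1(M_2(\cdots(M_{r-1}(M_r\oplus 1)\oplus 1)\cdots)\oplus 1)$$ over $\mathbb{F}_2$. Write $\mathbf{x}=(\mathbf{x_1},\dots,\mathbf{x_r})\in\mathbb{F}_2^n$ where $\mathbf{x_i}$ consists of the $k_i$ bits that are the variables of $M_i$. Suppose that for some $i$ the subword $\mathbf{x_i}$ contains more than one zero bit, and let $\mathbf{x'}$ be obtained from $\mathbf{x}$ by keeping exactly one of these zero bits of $\mathbf{x_i}$ and flipping the other zero bits of $\mathbf{x_i}$ to $1$. Then $s(f;\mathbf{x})\le s(f;\mathbf{x'})$ and $bs(f;\mathbf{x})=bs(f;\mathbf{x'})$.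
   Context: $\mathbb{F}_2$ is the field with two elements, $\oplus$ is addition mod 2. For $\mathbf{x}\in\mathbb{F}_2^n$ and $S\subseteq[n]=\{1,\dots,n\}$, $\mathbf{x}^S$ denotes $\mathbf{x}$ with the bits indexed by $S$ complemented, and $\mathbf{x}^i=\mathbf{x}^{\{i\}}$. The sensitivity $s(f;\mathbf{x})$ is the number of indices $i$ with $f(\mathbf{x})\ne f(\mathbf{x}^i)$. The block sensitivity $bs(f;\mathbf{x})$ is the maximum number $t$ of pairwise disjoint subsets $B_1,\dots,B_t$ of $[n]$ such that $f(\mathbf{x}^{B_j})\ne f(\mathbf{x})$ for all $j$. -}

module Defs where

open import Data.Bool using (Bool; true; false; _∧_; not; _xor_; if_then_else_)
open import Data.Bool.Properties using () renaming (_≟_ to _≟ᵇ_)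
open import Data.Nat using (ℕ; zero; suc; _+_)
open import Data.List using (List; []; _∷_; length; filter; allFin)
open import Data.Nat.ListAction using (sum)
open import Data.Vec using (Vec; []; _∷_; take; drop; zipWith; toList; foldr)
open import Data.Vec.Properties using (≡-dec)
open import Data.Fin using (Fin; zero; suc; splitAt)
open import Data.Fin.Subset using (Subset; ⁅_⁆; _∩_; ⊥)
open import Data.Fin.Subset.Properties using (anySubset?)
open import Data.Sum using ([_,_]′)
open import Data.Product using (Σ; _×_; _,_; ∃)
open import Data.List.Relation.Unary.All using (All; all?)
open import Data.List.Relation.Unary.AllPairs using (AllPairs; allPairs?)
open import Relation.Nullary using (Dec; yes; no; ¬_; ¬?; _×-dec_)
import Relation.Nullary.Decidable as Dec
open import Relation.Binary.PropositionalEquality using (_≡_; _≢_; refl)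

-- Bit vectors in F_2^n are Vec Bool n (true = 1, false = 0, xor = ⊕).

flipSet : {n : ℕ} → Vec Bool n → Subset n → Vec Bool n
flipSet x S = zipWith _xor_ x S

flipAt : {n : ℕ} → Vec Bool n → Fin n → Vec Bool n
flipAt x i = flipSet x ⁅ i ⁆

sens : {n : ℕ} → (Vec Bool n → Bool) → Vec Bool n → ℕ
sens {n} f x = length (filter (λ i → ¬? (f x ≟ᵇ f (flipAt x i))) (allFin n))

Sensitive : {n : ℕ} → (Vec Bool n → Bool) → Vec Bool n → Subset n → Set
Sensitive f x B = f (flipSet x B) ≢ f x

Disjoint : {n : ℕ} → Subset n → Subset n → Set
Disjoint B C = B ∩ C ≡ ⊥

HasBlocks : {n : ℕ} → (Vec Bool n → Bool) → Vec Bool n → ℕ → Set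
HasBlocks {n} f x t =
  Σ (Vec (Subset n) t) λ Bs → All (Sensitive f x) (toList Bs) × AllPairs Disjoint (toList Bs)

anyVecSubset? : {n : ℕ} (t : ℕ) (P : Vec (Subset n) t → Set) →
                ((Bs : Vec (Subset n) t) → Dec (P Bs)) → Dec (∃ P)
anyVecSubset? zero P P? = Dec.map′ (λ p → [] , p) (λ { ([] , p) → p }) (P? [])
anyVecSubset? (suc t) P P? =
  Dec.map′ (λ { (B , Bs , p) → (B ∷ Bs) , p })
           (λ { ((B ∷ Bs) , p) → B , Bs , p })
           (anySubset? (λ B → anyVecSubset? t (λ Bs → P (B ∷ Bs)) (λ Bs → P? (B ∷ Bs))))

hasBlocks? : {n : ℕ} (f : Vec Bool n → Bool) (x : Vec Bool n) (t : ℕ) → Dec (HasBlocks f x t)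
hasBlocks? {n} f x t = anyVecSubset? t _ λ Bs →
  all? (λ B → ¬? (f (flipSet x B) ≟ᵇ f x)) (toList Bs)
  ×-dec allPairs? (λ B C → ≡-dec _≟ᵇ_ (B ∩ C) ⊥) (toList Bs)

maxUpTo : (P : ℕ → Set) → ((t : ℕ) → Dec (P t)) → ℕ → ℕ
maxUpTo P P? zero = zero
maxUpTo P P? (suc m) with P? (suc m)
... | yes _ = suc m
... | no  _ = maxUpTo P P? m

-- Sensitive blocks are nonempty, so disjoint families have at most n members;
-- hence the maximum over t ≤ n is the maximum overall (t = 0 is always attained).
bsens : {n : ℕ} → (Vec Bool n → Bool) → Vec Bool n → ℕ
bsens {n} f x = maxUpTo (HasBlocks f x) (hasBlocks? f x) n

prodBits : {k : ℕ} → Vec Bool k → Bool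
prodBits = foldr _ _∧_ true

-- f for block sizes ks = (k_1,…,k_r):
--   f_{[]} = 0,  f_{k ∷ ks}(x) = M_1(x) · (f_{ks}(rest) ⊕ 1)
-- so f_{[k]} = M_1 and f = M_1(M_2(⋯(M_{r-1}(M_r ⊕ 1) ⊕ 1)⋯) ⊕ 1).
nestedF : (ks : List ℕ) → Vec Bool (sum ks) → Bool
nestedF [] x = false
nestedF (k ∷ ks) x = prodBits (take k x) ∧ not (nestedF ks (drop k x))

-- index (0-based) of the block M_i containing the variable at position j
blockOf : (ks : List ℕ) → Fin (sum ks) → Fin (length ks)
blockOf [] ()
blockOf (k ∷ ks) j = [ (λ _ → zero) , (λ j' → suc (blockOf ks j')) ]′ (splitAt k j)

module Submission where

-- Call a set R of coordinates a region, and say that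
-- f : F₂ⁿ → F₂ respects R if f(y) depends only on the bits of y outside R and
-- on whether y is all-ones on R.  The nested function f = M₁(M₂(⋯)⊕1) respects
-- the region of every block Mᵢ: the bits of Mᵢ enter f only through the
-- product Mᵢ.  For an arbitrary f respecting R we show:
--   * if x has two zeros in R, no bit of R is sensitive at x, and bits outside
--     R are sensitive at x exactly when they are sensitive at any w that agrees
--     with x outside R and has a zero in R; hence s(f;x) ≤ s(f;w);
--   * if x and w agree outside R and both have a zero in R, a sensitive block B
--     at x can be transported to one at w (keep B outside R; inside R, make
--     w^B all-ones on R iff x^B is), preserving disjointness, since two blocks
--     turning R all-ones at x would both contain a zero of x; by symmetry
--     bs(f;x) = bs(f;w).
-- The word x' of the theorem agrees with x outside the block and keeps the
-- zero j₀, so both facts apply to it.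

open import Defs
open import Data.Bool using (Bool; true; false; if_then_else_; _∧_; not; _xor_)
open import Data.Bool.Properties using (xor-comm; xor-same; not-distribʳ-xor; ∧-zeroʳ)
  renaming (_≟_ to _≟ᵇ_)
open import Data.Nat using (ℕ; _≤_; _+_)
open import Data.List using (List; _∷_; []; _++_; length; allFin)
open import Data.Nat.ListAction using (sum)
open import Data.List.Relation.Unary.All using (All)
import Data.List.Relation.Unary.All as All
import Data.List.Relation.Unary.All.Properties as All
open import Data.List.Relation.Unary.AllPairs using (AllPairs)
import Data.List.Relation.Unary.AllPairs as AllPairs
import Data.List.Relation.Unary.AllPairs.Properties as AllPairs
open import Data.List.Relation.Binary.Sublist.Propositional using (⊆-refl)
open import Data.List.Relation.Binary.Sublist.Propositional.Properties using (filter⁺; length-mono-≤)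
open import Data.Vec using (Vec; lookup; tabulate; take; drop; map; _∷_; [])
open import Data.Vec.Properties
  using (lookup-zipWith; lookup-replicate; lookup∘tabulate; lookup-++ˡ; lookup-++ʳ; toList-map;
         tabulate∘lookup; tabulate-cong; lookup⇒[]=; take++drop≡id)
open import Data.Fin using (Fin; _≟_; _↑ˡ_; _↑ʳ_; splitAt; zero; suc)
open import Data.Fin.Properties using (0≢1+n; splitAt-↑ˡ; splitAt-↑ʳ; splitAt⁻¹-↑ˡ; splitAt⁻¹-↑ʳ; all?; suc-injective)
open import Data.Fin.Subset using (Subset; ⁅_⁆)
open import Data.Fin.Subset.Properties using (x∈⁅y⁆⇒x≡y)
open import Data.Product using (Σ; _×_; _,_)
open import Data.Sum using (inj₁; inj₂)
open import Data.Empty using (⊥-elim) renaming (⊥ to Empty)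
open import Function using (_∘_; _⇔_; mk⇔; Equivalence)
open import Function.Construct.Composition using (_⇔-∘_)
open import Function.Construct.Symmetry using (⇔-sym)
open import Relation.Nullary using (does; Dec; yes; no; ¬_; _→-dec_; contradiction)
open import Relation.Unary using (Decidable)
open import Relation.Binary.PropositionalEquality
  using (_≡_; _≢_; refl; sym; trans; cong; cong₂; subst; module ≡-Reasoning)

vec-ext : {A : Set} {n : ℕ} (xs ys : Vec A n) → (∀ j → lookup xs j ≡ lookup ys j) → xs ≡ ys
vec-ext xs ys same = begin
  xs                   ≡⟨ sym (tabulate∘lookup xs) ⟩
  tabulate (lookup xs) ≡⟨ tabulate-cong same ⟩
  tabulate (lookup ys) ≡⟨ tabulate∘lookup ys ⟩
  ys                   ∎
  where open ≡-Reasoning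

bool-ext : {a b : Bool} → a ≡ true ⇔ b ≡ true → a ≡ b
bool-ext {false} {false} _     = refl
bool-ext {false} {true}  a⇔b = Equivalence.from a⇔b refl
bool-ext {true}  {false} a⇔b = sym (Equivalence.to a⇔b refl)
bool-ext {true}  {true}  _     = refl

if-yes : {A : Set} (d : Dec A) {a b : Bool} → A → (if does d then a else b) ≡ a
if-yes (yes _) _ = refl
if-yes (no ¬p) p = contradiction p ¬p

if-no : {A : Set} (d : Dec A) {a b : Bool} → ¬ A → (if does d then a else b) ≡ b
if-no (yes p) ¬p = contradiction p ¬p
if-no (no _)  _  = refl

lookup-flipSet : {n : ℕ} (y S : Vec Bool n) (j : Fin n) →
                 lookup (flipSet y S) j ≡ lookup y j xor lookup S j
lookup-flipSet y S j = lookup-zipWith _xor_ j y S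

lookup-⁅⁆-other : {n : ℕ} (k j : Fin n) → j ≢ k → lookup ⁅ k ⁆ j ≡ false
lookup-⁅⁆-other k j j≢k with lookup ⁅ k ⁆ j in eq
... | false = refl
... | true  = contradiction (x∈⁅y⁆⇒x≡y k (lookup⇒[]= j ⁅ k ⁆ eq)) j≢k

flipAt-other : {n : ℕ} (y : Vec Bool n) (k j : Fin n) → j ≢ k → lookup (flipAt y k) j ≡ lookup y j
flipAt-other y k j j≢k = begin
  lookup (flipAt y k) j          ≡⟨ lookup-flipSet y ⁅ k ⁆ j ⟩
  lookup y j xor lookup ⁅ k ⁆ j  ≡⟨ cong (lookup y j xor_) (lookup-⁅⁆-other k j j≢k) ⟩
  lookup y j xor false           ≡⟨ xor-comm (lookup y j) false ⟩
  lookup y j                     ∎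
  where open ≡-Reasoning

disjoint⇒pointwise : {n : ℕ} (B C : Subset n) → Disjoint B C → ∀ j → lookup B j ∧ lookup C j ≡ false
disjoint⇒pointwise B C B∩C≡⊥ j =
  trans (sym (lookup-zipWith _∧_ j B C)) (trans (cong (λ v → lookup v j) B∩C≡⊥) (lookup-replicate j false))

pointwise⇒disjoint : {n : ℕ} (B C : Subset n) → (∀ j → lookup B j ∧ lookup C j ≡ false) → Disjoint B C
pointwise⇒disjoint B C pw =
  vec-ext _ _ λ j → trans (lookup-zipWith _∧_ j B C) (trans (pw j) (sym (lookup-replicate j false)))

maxUpTo-cong : (P Q : ℕ → Set) (P? : (t : ℕ) → Dec (P t)) (Q? : (t : ℕ) → Dec (Q t)) →
               (∀ t → P t → Q t) → (∀ t → Q t → P t) → ∀ m → maxUpTo P P? m ≡ maxUpTo Q Q? m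
maxUpTo-cong P Q P? Q? P⇒Q Q⇒P 0 = refl
maxUpTo-cong P Q P? Q? P⇒Q Q⇒P (ℕ.suc m) with P? (ℕ.suc m) | Q? (ℕ.suc m)
... | yes _  | yes _  = refl
... | yes p  | no ¬q  = contradiction (P⇒Q _ p) ¬q
... | no ¬p  | yes q  = contradiction (Q⇒P _ q) ¬p
... | no _   | no _   = maxUpTo-cong P Q P? Q? P⇒Q Q⇒P m

module Region {n : ℕ} (R : Fin n → Set) where

  AllOnes : Vec Bool n → Set
  AllOnes y = ∀ j → R j → lookup y j ≡ true

  HasZero : Vec Bool n → Set
  HasZero y = Σ (Fin n) λ j → R j × lookup y j ≡ false

  hasZero⇒¬allOnes : ∀ {y} → HasZero y → ¬ AllOnes y
  hasZero⇒¬allOnes (j , Rj , yj≡0) allOnes with trans (sym yj≡0) (allOnes j Rj)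
  ... | ()

  AgreeOutside : Vec Bool n → Vec Bool n → Set
  AgreeOutside y z = ∀ j → ¬ R j → lookup y j ≡ lookup z j

  Respects : (Vec Bool n → Bool) → Set
  Respects f = ∀ y z → AgreeOutside y z → AllOnes y ⇔ AllOnes z → f y ≡ f z

  respects-zeros : ∀ {f} → Respects f → ∀ {y z} → AgreeOutside y z → HasZero y → HasZero z → f y ≡ f z
  respects-zeros resp {y} {z} agree zy zz =
    resp y z agree (mk⇔ (λ a → contradiction a (hasZero⇒¬allOnes {y} zy)) (λ a → contradiction a (hasZero⇒¬allOnes {z} zz)))

  agreeOutside-flipSet : ∀ {y z} → AgreeOutside y z → ∀ S → AgreeOutside (flipSet y S) (flipSet z S)
  agreeOutside-flipSet {y} {z} agree S j ¬Rj = begin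
    lookup (flipSet y S) j    ≡⟨ lookup-flipSet y S j ⟩
    lookup y j xor lookup S j ≡⟨ cong (_xor lookup S j) (agree j ¬Rj) ⟩
    lookup z j xor lookup S j ≡⟨ sym (lookup-flipSet z S j) ⟩
    lookup (flipSet z S) j    ∎
    where open ≡-Reasoning

  flipAt-keeps-zero : ∀ y j → R j → lookup y j ≡ false → ∀ k → j ≢ k → HasZero (flipAt y k)
  flipAt-keeps-zero y j Rj yj≡0 k j≢k = j , Rj , trans (flipAt-other y k j j≢k) yj≡0

  flip-allOnes⇒contains : ∀ x D j → R j → lookup x j ≡ false → AllOnes (flipSet x D) → lookup D j ≡ true
  flip-allOnes⇒contains x D j Rj xj≡0 a =
    trans (cong (_xor lookup D j) (sym xj≡0)) (trans (sym (lookup-flipSet x D j)) (a j Rj))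

  module Decided (R? : Decidable R) where

    allOnes? : (y : Vec Bool n) → Dec (AllOnes y)
    allOnes? y = all? (λ j → R? j →-dec (lookup y j ≟ᵇ true))

    collapse : Vec Bool n → Fin n → Vec Bool n
    collapse x j₀ = tabulate (λ j → if does (R? j) then (if does (j ≟ j₀) then lookup x j else true) else lookup x j)

    collapse-agrees : ∀ x j₀ → AgreeOutside x (collapse x j₀)
    collapse-agrees x j₀ j ¬Rj = sym (trans (lookup∘tabulate _ j) (if-no (R? j) ¬Rj))

    collapse-keeps : ∀ x j₀ → R j₀ → lookup (collapse x j₀) j₀ ≡ lookup x j₀
    collapse-keeps x j₀ Rj₀ =
      trans (lookup∘tabulate _ j₀) (trans (if-yes (R? j₀) Rj₀) (if-yes (j₀ ≟ j₀) refl))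

    module _ {f : Vec Bool n → Bool} (resp : Respects f) where

      -- With two zeros of x in R, flipping a bit of R still leaves a zero in R,
      -- so only bits outside R can be sensitive at x.
      insensitive-inside : ∀ {x} j₀ j₁ → j₁ ≢ j₀ → R j₀ → lookup x j₀ ≡ false → R j₁ → lookup x j₁ ≡ false →
                           ∀ k → R k → f x ≡ f (flipAt x k)
      insensitive-inside {x} j₀ j₁ j₁≢j₀ Rj₀ xj₀≡0 Rj₁ xj₁≡0 k Rk =
        respects-zeros resp agree (j₀ , Rj₀ , xj₀≡0) zero-after-flip
        where
        agree : AgreeOutside x (flipAt x k)
        agree j ¬Rj = sym (flipAt-other x k j λ { refl → ¬Rj Rk })
        zero-after-flip : HasZero (flipAt x k)
        zero-after-flip with j₀ ≟ k
        ... | yes refl = flipAt-keeps-zero x j₁ Rj₁ xj₁≡0 k j₁≢j₀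
        ... | no j₀≢k  = flipAt-keeps-zero x j₀ Rj₀ xj₀≡0 k j₀≢k

      sensitive-outside : ∀ {x w} → AgreeOutside x w → HasZero x → HasZero w →
                          ∀ k → ¬ R k → f x ≢ f (flipAt x k) → f w ≢ f (flipAt w k)
      sensitive-outside {x} {w} agree zx@(jx , Rjx , xjx≡0) zw@(jw , Rjw , wjw≡0) k ¬Rk fx≢fxᵏ fw≡fwᵏ =
        fx≢fxᵏ (begin
          f x             ≡⟨ respects-zeros resp agree zx zw ⟩
          f w             ≡⟨ fw≡fwᵏ ⟩
          f (flipAt w k)  ≡⟨ respects-zeros resp (λ j ¬Rj → sym (agreeOutside-flipSet {x} {w} agree ⁅ k ⁆ j ¬Rj))
                               (flipAt-keeps-zero w jw Rjw wjw≡0 k (outside Rjw))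
                               (flipAt-keeps-zero x jx Rjx xjx≡0 k (outside Rjx)) ⟩
          f (flipAt x k)  ∎)
        where
        open ≡-Reasoning
        outside : ∀ {j} → R j → j ≢ k
        outside Rj refl = ¬Rk Rj

      sens-mono : ∀ {x w} j₀ j₁ → j₁ ≢ j₀ → R j₀ → lookup x j₀ ≡ false → R j₁ → lookup x j₁ ≡ false →
                  AgreeOutside x w → HasZero w → sens f x ≤ sens f w
      sens-mono {x} {w} j₀ j₁ j₁≢j₀ Rj₀ xj₀≡0 Rj₁ xj₁≡0 agree zw =
        length-mono-≤ (filter⁺ _ _ (λ { refl → sensitive-at-w _ }) (⊆-refl {x = allFin n}))
        where
        sensitive-at-w : ∀ k → f x ≢ f (flipAt x k) → f w ≢ f (flipAt w k)
        sensitive-at-w k s with R? k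
        ... | yes Rk = contradiction (insensitive-inside j₀ j₁ j₁≢j₀ Rj₀ xj₀≡0 Rj₁ xj₁≡0 k Rk) s
        ... | no ¬Rk = sensitive-outside agree (j₀ , Rj₀ , xj₀≡0) zw k ¬Rk s

      module Transport {x w : Vec Bool n} (agree : AgreeOutside x w) (zx : HasZero x) (zw : HasZero w) where

        -- Outside R a block is kept; inside R it is chosen so that w^B' is
        -- all-ones on R exactly when x^B is.
        transport : Subset n → Subset n
        transport B = tabulate λ j →
          if does (R? j) then (if does (allOnes? (flipSet x B)) then not (lookup w j) else false)
          else lookup B j

        transport-outside : ∀ B j → ¬ R j → lookup (transport B) j ≡ lookup B j
        transport-outside B j ¬Rj = trans (lookup∘tabulate _ j) (if-no (R? j) ¬Rj)

        transport-allOnes : ∀ B j → R j → AllOnes (flipSet x B) → lookup (transport B) j ≡ not (lookup w j)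
        transport-allOnes B j Rj a =
          trans (lookup∘tabulate _ j) (trans (if-yes (R? j) Rj) (if-yes (allOnes? (flipSet x B)) a))

        transport-notAllOnes : ∀ B j → R j → ¬ AllOnes (flipSet x B) → lookup (transport B) j ≡ false
        transport-notAllOnes B j Rj ¬a =
          trans (lookup∘tabulate _ j) (trans (if-yes (R? j) Rj) (if-no (allOnes? (flipSet x B)) ¬a))

        transport-agrees : ∀ B → AgreeOutside (flipSet w (transport B)) (flipSet x B)
        transport-agrees B j ¬Rj = begin
          lookup (flipSet w (transport B)) j     ≡⟨ lookup-flipSet w (transport B) j ⟩
          lookup w j xor lookup (transport B) j  ≡⟨ cong₂ _xor_ (sym (agree j ¬Rj)) (transport-outside B j ¬Rj) ⟩
          lookup x j xor lookup B j              ≡⟨ sym (lookup-flipSet x B j) ⟩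
          lookup (flipSet x B) j                 ∎
          where open ≡-Reasoning

        transport-value : ∀ B → f (flipSet w (transport B)) ≡ f (flipSet x B)
        transport-value B with allOnes? (flipSet x B)
        ... | yes a  = resp _ _ (transport-agrees B) (mk⇔ (λ _ → a) (λ _ → w-allOnes))
          where
          w-allOnes : AllOnes (flipSet w (transport B))
          w-allOnes j Rj = begin
            lookup (flipSet w (transport B)) j        ≡⟨ lookup-flipSet w (transport B) j ⟩
            lookup w j xor lookup (transport B) j     ≡⟨ cong (lookup w j xor_) (transport-allOnes B j Rj a) ⟩
            lookup w j xor not (lookup w j)           ≡⟨ sym (not-distribʳ-xor (lookup w j) (lookup w j)) ⟩
            not (lookup w j xor lookup w j)           ≡⟨ cong not (xor-same (lookup w j)) ⟩
            true                                      ∎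
            where open ≡-Reasoning
        ... | no ¬a  = resp _ _ (transport-agrees B)
          (mk⇔ (λ a' → contradiction a' (hasZero⇒¬allOnes {flipSet w (transport B)} w-zero))
               (λ a' → contradiction a' ¬a))
          where
          w-zero : HasZero (flipSet w (transport B))
          w-zero = let (j , Rj , wj≡0) = zw in
            j , Rj , trans (lookup-flipSet w (transport B) j)
                           (cong₂ _xor_ wj≡0 (transport-notAllOnes B j Rj ¬a))

        -- Since f(w) = f(x), a sensitive block at x is carried to one at w.
        transport-sensitive : ∀ B → Sensitive f x B → Sensitive f w (transport B)
        transport-sensitive B sens-B fw^B'≡fw =
          sens-B (trans (sym (transport-value B)) (trans fw^B'≡fw (sym (respects-zeros resp agree zx zw))))

        -- Inside R two transported blocks can only meet if both B and C turn x
        -- all-ones on R; then both contain the zero of x, contradicting disjointness.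
        transport-disjoint : ∀ B C → Disjoint B C → Disjoint (transport B) (transport C)
        transport-disjoint B C B∩C≡⊥ = pointwise⇒disjoint (transport B) (transport C) pointwise
          where
          pointwise : ∀ j → lookup (transport B) j ∧ lookup (transport C) j ≡ false
          pointwise j with R? j | allOnes? (flipSet x B) | allOnes? (flipSet x C)
          ... | no ¬Rj | _ | _ = trans (cong₂ _∧_ (transport-outside B j ¬Rj) (transport-outside C j ¬Rj))
                                       (disjoint⇒pointwise B C B∩C≡⊥ j)
          ... | yes Rj | no ¬aB | _ = cong (_∧ lookup (transport C) j) (transport-notAllOnes B j Rj ¬aB)
          ... | yes Rj | yes _ | no ¬aC = trans (cong (lookup (transport B) j ∧_) (transport-notAllOnes C j Rj ¬aC))
                                                (∧-zeroʳ _)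
          ... | yes _ | yes aB | yes aC = ⊥-elim (meet zx)
            where
            meet : HasZero x → Empty
            meet (jx , Rjx , xjx≡0) = true≢false (begin
              true                        ≡⟨ cong₂ _∧_ (contains B aB) (contains C aC) ⟨
              lookup B jx ∧ lookup C jx   ≡⟨ disjoint⇒pointwise B C B∩C≡⊥ jx ⟩
              false                       ∎)
              where
              open ≡-Reasoning
              contains : ∀ D → AllOnes (flipSet x D) → lookup D jx ≡ true
              contains D = flip-allOnes⇒contains x D jx Rjx xjx≡0
              true≢false : true ≢ false
              true≢false ()

        hasBlocks-transport : ∀ t → HasBlocks f x t → HasBlocks f w t
        hasBlocks-transport t (Bs , sensitive , disjoint) =
          map transport Bs ,
          subst (All (Sensitive f w)) (sym (toList-map transport Bs))
                (All.map⁺ (All.map (λ {B} → transport-sensitive B) sensitive)) ,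
          subst (AllPairs Disjoint) (sym (toList-map transport Bs))
                (AllPairs.map⁺ (AllPairs.map (λ {B} {C} → transport-disjoint B C) disjoint))

      bsens-eq : ∀ {x w} → AgreeOutside x w → HasZero x → HasZero w → bsens f x ≡ bsens f w
      bsens-eq agree zx zw = maxUpTo-cong _ _ _ _
        (Transport.hasBlocks-transport agree zx zw)
        (Transport.hasBlocks-transport (λ j ¬Rj → sym (agree j ¬Rj)) zw zx) n

split-induction : ∀ k m (P : Fin (k + m) → Set) → (∀ a → P (a ↑ˡ m)) → (∀ b → P (k ↑ʳ b)) → ∀ j → P j
split-induction k m P left right j with splitAt k j in eq
... | inj₁ a = subst P (splitAt⁻¹-↑ˡ eq) (left a)
... | inj₂ b = subst P (splitAt⁻¹-↑ʳ eq) (right b)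

lookup-↑ˡ : ∀ k {m} (y : Vec Bool (k + m)) a → lookup y (a ↑ˡ m) ≡ lookup (take k y) a
lookup-↑ˡ k {m} y a =
  trans (cong (λ v → lookup v (a ↑ˡ m)) (sym (take++drop≡id k y))) (lookup-++ˡ (take k y) (drop k y) a)

lookup-↑ʳ : ∀ k {m} (y : Vec Bool (k + m)) b → lookup y (k ↑ʳ b) ≡ lookup (drop k y) b
lookup-↑ʳ k y b =
  trans (cong (λ v → lookup v (k ↑ʳ b)) (sym (take++drop≡id k y))) (lookup-++ʳ (take k y) (drop k y) b)

blockOf-↑ˡ : ∀ k ks (a : Fin k) → blockOf (k ∷ ks) (a ↑ˡ sum ks) ≡ zero
blockOf-↑ˡ k ks a rewrite splitAt-↑ˡ k a (sum ks) = refl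

blockOf-↑ʳ : ∀ k ks (b : Fin (sum ks)) → blockOf (k ∷ ks) (k ↑ʳ b) ≡ suc (blockOf ks b)
blockOf-↑ʳ k ks b rewrite splitAt-↑ʳ k (sum ks) b = refl

prodBits-true : ∀ {k} (v : Vec Bool k) → prodBits v ≡ true ⇔ (∀ a → lookup v a ≡ true)
prodBits-true v = mk⇔ (to v) (from v)
  where
  to : ∀ {k} (v : Vec Bool k) → prodBits v ≡ true → ∀ a → lookup v a ≡ true
  to (true ∷ v) p zero    = refl
  to (true ∷ v) p (suc a) = to v p a
  from : ∀ {k} (v : Vec Bool k) → (∀ a → lookup v a ≡ true) → prodBits v ≡ true
  from []      _   = refl
  from (b ∷ v) all = cong₂ _∧_ (all zero) (from v (all ∘ suc))

module Block (ks : List ℕ) (i : Fin (length ks)) = Region (λ j → blockOf ks j ≡ i)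

headBlock-allOnes : ∀ k ks (y : Vec Bool (k + sum ks)) → prodBits (take k y) ≡ true ⇔ Block.AllOnes (k ∷ ks) zero y
headBlock-allOnes k ks y = mk⇔ to from
  where
  to : prodBits (take k y) ≡ true → Block.AllOnes (k ∷ ks) zero y
  to M₁≡1 = split-induction k (sum ks) (λ j → blockOf (k ∷ ks) j ≡ zero → lookup y j ≡ true)
    (λ a _ → trans (lookup-↑ˡ k y a) (Equivalence.to (prodBits-true (take k y)) M₁≡1 a))
    (λ b inHead → contradiction (trans (sym inHead) (blockOf-↑ʳ k ks b)) 0≢1+n)
  from : Block.AllOnes (k ∷ ks) zero y → prodBits (take k y) ≡ true
  from allOnes = Equivalence.from (prodBits-true (take k y))
    λ a → trans (sym (lookup-↑ˡ k y a)) (allOnes (a ↑ˡ sum ks) (blockOf-↑ˡ k ks a))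

tailBlock-allOnes : ∀ k ks i (y : Vec Bool (k + sum ks)) →
                    Block.AllOnes ks i (drop k y) ⇔ Block.AllOnes (k ∷ ks) (suc i) y
tailBlock-allOnes k ks i y = mk⇔ to from
  where
  to : Block.AllOnes ks i (drop k y) → Block.AllOnes (k ∷ ks) (suc i) y
  to allOnes = split-induction k (sum ks) (λ j → blockOf (k ∷ ks) j ≡ suc i → lookup y j ≡ true)
    (λ a inBlock → contradiction (trans (sym (blockOf-↑ˡ k ks a)) inBlock) 0≢1+n)
    (λ b inBlock → trans (lookup-↑ʳ k y b) (allOnes b (suc-injective (trans (sym (blockOf-↑ʳ k ks b)) inBlock))))
  from : Block.AllOnes (k ∷ ks) (suc i) y → Block.AllOnes ks i (drop k y)
  from allOnes b inBlock = trans (sym (lookup-↑ʳ k y b)) (allOnes (k ↑ʳ b) (trans (blockOf-↑ʳ k ks b) (cong suc inBlock)))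

head-outside-tail : ∀ k ks (y z : Vec Bool (k + sum ks)) → Block.AgreeOutside (k ∷ ks) zero y z → drop k y ≡ drop k z
head-outside-tail k ks y z agree = vec-ext _ _ λ b →
  trans (sym (lookup-↑ʳ k y b))
        (trans (agree (k ↑ʳ b) (λ inHead → 0≢1+n (trans (sym inHead) (blockOf-↑ʳ k ks b)))) (lookup-↑ʳ k z b))

tail-outside-head : ∀ k ks i (y z : Vec Bool (k + sum ks)) → Block.AgreeOutside (k ∷ ks) (suc i) y z → take k y ≡ take k z
tail-outside-head k ks i y z agree = vec-ext _ _ λ a →
  trans (sym (lookup-↑ˡ k y a))
        (trans (agree (a ↑ˡ sum ks) (λ inBlock → 0≢1+n (trans (sym (blockOf-↑ˡ k ks a)) inBlock))) (lookup-↑ˡ k z a))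

tail-agreeOutside : ∀ k ks i (y z : Vec Bool (k + sum ks)) →
                    Block.AgreeOutside (k ∷ ks) (suc i) y z → Block.AgreeOutside ks i (drop k y) (drop k z)
tail-agreeOutside k ks i y z agree b outside =
  trans (sym (lookup-↑ʳ k y b))
        (trans (agree (k ↑ʳ b) (λ inBlock → outside (suc-injective (trans (sym (blockOf-↑ʳ k ks b)) inBlock))))
               (lookup-↑ʳ k z b))

nestedF-respects : ∀ ks i → Block.Respects ks i (nestedF ks)
nestedF-respects (k ∷ ks) zero y z agree allOnes⇔ =
  cong₂ _∧_ (bool-ext (⇔-sym (headBlock-allOnes k ks z) ⇔-∘ (allOnes⇔ ⇔-∘ headBlock-allOnes k ks y)))
            (cong (not ∘ nestedF ks) (head-outside-tail k ks y z agree))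
nestedF-respects (k ∷ ks) (suc i) y z agree allOnes⇔ =
  cong₂ _∧_ (cong prodBits (tail-outside-head k ks i y z agree))
            (cong not (nestedF-respects ks i (drop k y) (drop k z) (tail-agreeOutside k ks i y z agree)
                        (⇔-sym (tailBlock-allOnes k ks i z) ⇔-∘ (allOnes⇔ ⇔-∘ tailBlock-allOnes k ks i y))))

-- The theorem: x' is the collapse of x onto its zero j₀ inside block i.
lemma3p2 : (ks : List ℕ) (kr : ℕ) →
           let blocks = ks ++ (kr ∷ []) in
           2 ≤ sum blocks → All (1 ≤_) ks → 2 ≤ kr →
           (x : Vec Bool (sum blocks)) (i : Fin (length blocks)) (j₀ : Fin (sum blocks)) →
           blockOf blocks j₀ ≡ i → lookup x j₀ ≡ false →
           Σ (Fin (sum blocks)) (λ j₁ → j₁ ≢ j₀ × blockOf blocks j₁ ≡ i × lookup x j₁ ≡ false) →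
           let x' = tabulate (λ j → if does (blockOf blocks j ≟ i) then
                                      (if does (j ≟ j₀) then lookup x j else true)
                                    else lookup x j) in
           (sens (nestedF blocks) x ≤ sens (nestedF blocks) x')
           × (bsens (nestedF blocks) x ≡ bsens (nestedF blocks) x')
lemma3p2 ks kr _ _ _ x i j₀ inBlock-j₀ xj₀≡0 (j₁ , j₁≢j₀ , inBlock-j₁ , xj₁≡0) =
  sens-mono respects j₀ j₁ j₁≢j₀ inBlock-j₀ xj₀≡0 inBlock-j₁ xj₁≡0 (collapse-agrees x j₀) zero-of-x' ,
  bsens-eq respects (collapse-agrees x j₀) (j₀ , inBlock-j₀ , xj₀≡0) zero-of-x'
  where
  blocks : List ℕ
  blocks = ks ++ (kr ∷ [])
  open Block blocks i
  open Decided (λ j → blockOf blocks j ≟ i)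
  respects : Respects (nestedF blocks)
  respects = nestedF-respects blocks i
  zero-of-x' : HasZero (collapse x j₀)
  zero-of-x' = j₀ , inBlock-j₀ , trans (collapse-keeps x j₀ inBlock-j₀) xj₀≡0
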